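{- For non-zero integers $a$ and $b$ let $G_{a,b}=\{(\gcd(a,c),\gcd(a,b-c)) : c\in\mathbb{Z}\}$. Then $G_{a,b}=G_{a,d}$, where $d=\gcd(a,b)$. -}

module Defs where

open import Data.Integer using (ℤ; _-_)
open import Data.Integer.GCD using (gcd)
open import Data.Product using (_×_; ∃-syntax)
open import Relation.Binary.PropositionalEquality using (_≡_)

InG : ℤ → ℤ → ℤ → ℤ → Set
InG a b x y = ∃[ c ] (gcd a c ≡ x × gcd a (b - c) ≡ y)

-- Call b and d associated modulo a if b ≡ k d (mod a) for some k invertible modulo a.
-- Multiplying by a unit does not change gcd(a, ·), and gcd(a, ·) depends only on the
-- residue modulo a; since b − k c ≡ k (d − c), the map c ↦ k c turns a witness of
-- (x, y) ∈ G_{a,d} into one of (x, y) ∈ G_{a,b}, and the inverse of k maps back.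
-- So it suffices that b is associated to d = gcd(a, b) modulo a. Write a = a′d and
-- b = b′d with a′, b′ coprime, and let m be the largest divisor of a coprime to b′.
-- Then K = b′ + a′m is coprime to a, because a prime divisor of a divides exactly
-- one of b′ and a′m, and K d = b + m a; for negative b take −K instead.
{-# OPTIONS --safe #-}
module Submission where

open import Defs
open import Data.Integer using (ℤ; 0ℤ)
open import Data.Integer.GCD using (gcd)
open import Data.Product using (_×_)
open import Relation.Binary.PropositionalEquality using (_≢_)

open import Function using (_∘_)
open import Data.Product using (_,_; proj₁; proj₂; ∃-syntax; map₂)
open import Relation.Nullary using (yes; no)
open import Relation.Binary.PropositionalEquality
  using (_≡_; refl; sym; trans; cong; cong₂; subst; ≢-sym; module ≡-Reasoning)
open import Induction.WellFounded using (Acc; acc)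

import Data.Nat as ℕ
import Data.Nat.Properties as ℕ
import Data.Nat.Divisibility as ℕ
import Data.Nat.DivMod as ℕ
import Data.Nat.GCD as ℕ
import Data.Nat.Induction as ℕ
import Data.Nat.Tactic.RingSolver as ℕ
open import Data.Nat.Coprimality
  using (Coprime; coprime?; coprime-+; coprime-divisor; coprime-/gcd; coprime-Bézout; gcd≡1⇒coprime)
  renaming (sym to coprime-sym)

open import Data.Integer using (+_; -[1+_]; -_; _+_; _-_; _*_; 1ℤ; ∣_∣)
open import Data.Integer.Properties using (∣i∣≡0⇒i≡0; pos-+; pos-*; *-comm; neg-distribˡ-*)
open import Data.Integer.Divisibility using () renaming (_∣_ to _∣ᵤ_)
open import Data.Integer.Divisibility.Signed
  using (_∣_; divides; ∣ᵤ⇒∣; ∣⇒∣ᵤ; ∣-trans; m∣∣m∣; ∣m∣n⇒∣m+n; ∣m∣n⇒∣m-n; ∣m⇒∣-m; ∣n⇒∣m*n; ∣m⇒∣m*n)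
open import Data.Integer.GCD using (gcd[i,j]∣i; gcd[i,j]∣j; gcd-greatest)
open import Data.Integer.Tactic.RingSolver using (solve-∀)

open ≡-Reasoning

coprime-∣ˡ : ∀ {m n o} → Coprime m n → o ℕ.∣ m → Coprime o n
coprime-∣ˡ m⊥n o∣m (i∣o , i∣n) = m⊥n (ℕ.∣-trans i∣o o∣m , i∣n)

coprime-*ˡ : ∀ {a m n} → Coprime a n → Coprime m n → Coprime (a ℕ.* m) n
coprime-*ˡ a⊥n m⊥n (i∣am , i∣n) =
  m⊥n (coprime-divisor (coprime-∣ˡ (coprime-sym a⊥n) i∣n) i∣am , i∣n)

coprime-part : ∀ b n → n ≢ 0 → Acc ℕ._<_ n →
               ∃[ m ] Coprime m b × (∀ {e} → e ℕ.∣ n → Coprime e b → e ℕ.∣ m)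
coprime-part b n n≢0 (acc rec) with coprime? n b | ℕ.gcd[m,n]∣m n b
... | yes n⊥b | _ = n , n⊥b , λ e∣n _ → e∣n
... | no ¬n⊥b | ℕ.divides q n≡q*g =
  map₂ (map₂ (λ absorbs e∣n e⊥b → absorbs (e∣q e∣n e⊥b) e⊥b)) (coprime-part b q q≢0 (rec q<n))
  where
  g = ℕ.gcd n b
  q≢0 : q ≢ 0
  q≢0 q≡0 = n≢0 (trans n≡q*g (cong (ℕ._* g) q≡0))
  1<g : 1 ℕ.< g
  1<g = ℕ.≤∧≢⇒< (ℕ.n≢0⇒n>0 (n≢0 ∘ ℕ.gcd[m,n]≡0⇒m≡0)) (≢-sym (¬n⊥b ∘ gcd≡1⇒coprime))
  q<n : q ℕ.< n
  q<n = subst (q ℕ.<_) (sym n≡q*g) (ℕ.m<m*n q g {{ℕ.≢-nonZero q≢0}} 1<g)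
  e∣q : ∀ {e} → e ℕ.∣ n → Coprime e b → e ℕ.∣ q
  e∣q e∣n e⊥b = coprime-divisor (coprime-sym (coprime-∣ˡ (coprime-sym e⊥b) (ℕ.gcd[m,n]∣n n b)))
                                (subst (_ ℕ.∣_) (trans n≡q*g (ℕ.*-comm q g)) e∣n)

coprime-shift : ∀ {a b n} → Coprime a b → n ≢ 0 → ∃[ m ] Coprime (b ℕ.+ a ℕ.* m) n
coprime-shift {a} {b} {n} a⊥b n≢0 with coprime-part b n n≢0 (ℕ.<-wellFounded n)
... | m , m⊥b , absorbs = m , K⊥n
  where
  K⊥b : Coprime (b ℕ.+ a ℕ.* m) b
  K⊥b = coprime-+ (coprime-*ˡ a⊥b m⊥b)
  K⊥n : Coprime (b ℕ.+ a ℕ.* m) n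
  K⊥n {e} (e∣K , e∣n) = K⊥b (e∣K , e∣b)
    where
    e∣am : e ℕ.∣ a ℕ.* m
    e∣am = ℕ.∣n⇒∣m*n a (absorbs e∣n (coprime-∣ˡ K⊥b e∣K))
    e∣b : e ℕ.∣ b
    e∣b = ℕ.∣m+n∣m⇒∣n (subst (e ℕ.∣_) (ℕ.+-comm b (a ℕ.* m)) e∣K) e∣am

∃-coprime-≡-mod : ∀ A B → A ≢ 0 → ∃[ K ] ∃[ m ] Coprime K A × K ℕ.* ℕ.gcd A B ≡ B ℕ.+ m ℕ.* A
∃-coprime-≡-mod A B A≢0 = b′ ℕ.+ a′ ℕ.* m , m , K⊥A , KD≡B+mA
  where
  D = ℕ.gcd A B
  instance
    D≢0 : ℕ.NonZero D
    D≢0 = ℕ.≢-nonZero (A≢0 ∘ ℕ.gcd[m,n]≡0⇒m≡0)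
  a′ = A ℕ./ D
  b′ = B ℕ./ D
  shift = coprime-shift (coprime-/gcd A B) A≢0
  m = proj₁ shift
  K⊥A = proj₂ shift
  KD≡B+mA : (b′ ℕ.+ a′ ℕ.* m) ℕ.* D ≡ B ℕ.+ m ℕ.* A
  KD≡B+mA = begin
    (b′ ℕ.+ a′ ℕ.* m) ℕ.* D     ≡⟨ rearrange b′ a′ m D ⟩
    b′ ℕ.* D ℕ.+ m ℕ.* (a′ ℕ.* D) ≡⟨ cong₂ (λ s t → s ℕ.+ m ℕ.* t) (ℕ.m/n*n≡m (ℕ.gcd[m,n]∣n A B))
                                                               (ℕ.m/n*n≡m (ℕ.gcd[m,n]∣m A B)) ⟩
    B ℕ.+ m ℕ.* A               ∎
    where
    rearrange : ∀ b a m d → (b ℕ.+ a ℕ.* m) ℕ.* d ≡ b ℕ.* d ℕ.+ m ℕ.* (a ℕ.* d)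
    rearrange = ℕ.solve-∀

pos-+-* : ∀ p q r → + (p ℕ.+ q ℕ.* r) ≡ + p + + q * + r
pos-+-* p q r = trans (pos-+ p (q ℕ.* r)) (cong (_+_ (+ p)) (pos-* q r))

∃-inverse-mod : ∀ {K A} → Coprime K A → ∃[ u ] + A ∣ + K * u - 1ℤ
∃-inverse-mod {K} {A} K⊥A with coprime-Bézout K⊥A
... | ℕ.Bézout.+- x y 1+yA≡xK = + x , divides (+ y) (begin
  + K * + x - 1ℤ       ≡⟨ cong (_- 1ℤ) (trans (*-comm (+ K) (+ x)) (sym (pos-* x K))) ⟩
  + (x ℕ.* K) - 1ℤ      ≡⟨ cong (λ t → + t - 1ℤ) 1+yA≡xK ⟨
  + (1 ℕ.+ y ℕ.* A) - 1ℤ ≡⟨ cong (_- 1ℤ) (pos-+-* 1 y A) ⟩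
  1ℤ + + y * + A - 1ℤ    ≡⟨ [1+t]-1≡t (+ y * + A) ⟩
  + y * + A             ∎)
  where
  [1+t]-1≡t : ∀ t → 1ℤ + t - 1ℤ ≡ t
  [1+t]-1≡t = solve-∀
... | ℕ.Bézout.-+ x y 1+xK≡yA = - + x , divides (- + y) (begin
  + K * - + x - 1ℤ       ≡⟨ k*-x-1≡-[1+x*k] (+ K) (+ x) ⟩
  - (1ℤ + + x * + K)     ≡⟨ cong -_ (pos-+-* 1 x K) ⟨
  - + (1 ℕ.+ x ℕ.* K)     ≡⟨ cong (λ t → - + t) 1+xK≡yA ⟩
  - + (y ℕ.* A)           ≡⟨ cong -_ (pos-* y A) ⟩
  - (+ y * + A)          ≡⟨ neg-distribˡ-* (+ y) (+ A) ⟩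
  - + y * + A            ∎)
  where
  k*-x-1≡-[1+x*k] : ∀ k x → k * - x - 1ℤ ≡ - (1ℤ + x * k)
  k*-x-1≡-[1+x*k] = solve-∀

gcd-antisym : ∀ a x y → gcd a x ∣ᵤ gcd a y → gcd a y ∣ᵤ gcd a x → gcd a x ≡ gcd a y
gcd-antisym _ _ _ p q = cong +_ (ℕ.∣-antisym p q)

gcd∣ˡ : ∀ a x → gcd a x ∣ a
gcd∣ˡ a x = ∣ᵤ⇒∣ {gcd a x} {a} (gcd[i,j]∣i a x)

gcd∣ʳ : ∀ a x → gcd a x ∣ x
gcd∣ʳ a x = ∣ᵤ⇒∣ {gcd a x} {x} (gcd[i,j]∣j a x)

gcd-greatestˢ : ∀ a x c → c ∣ a → c ∣ x → c ∣ᵤ gcd a x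
gcd-greatestˢ a x c c∣a c∣x = gcd-greatest {a} {x} {c} (∣⇒∣ᵤ c∣a) (∣⇒∣ᵤ c∣x)

gcd∣gcd[*] : ∀ a m c → gcd a c ∣ᵤ gcd a (m * c)
gcd∣gcd[*] a m c = gcd-greatestˢ a (m * c) (gcd a c) (gcd∣ˡ a c) (∣n⇒∣m*n m (gcd∣ʳ a c))

gcd∣gcd[≡] : ∀ a x y → a ∣ x - y → gcd a y ∣ᵤ gcd a x
gcd∣gcd[≡] a x y a∣x-y =
  gcd-greatestˢ a x (gcd a y) (gcd∣ˡ a y) (subst (gcd a y ∣_) ([x-y]+y≡x x y) g∣[x-y]+y)
  where
  g∣[x-y]+y : gcd a y ∣ (x - y) + y
  g∣[x-y]+y = ∣m∣n⇒∣m+n (∣-trans (gcd∣ˡ a y) a∣x-y) (gcd∣ʳ a y)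
  [x-y]+y≡x : ∀ x y → (x - y) + y ≡ x
  [x-y]+y≡x = solve-∀

gcd-cong : ∀ a x y → a ∣ x - y → gcd a x ≡ gcd a y
gcd-cong a x y a∣x-y =
  gcd-antisym a x y (gcd∣gcd[≡] a y x a∣y-x) (gcd∣gcd[≡] a x y a∣x-y)
  where
  -[x-y]≡y-x : ∀ x y → - (x - y) ≡ y - x
  -[x-y]≡y-x = solve-∀
  a∣y-x : a ∣ y - x
  a∣y-x = subst (a ∣_) (-[x-y]≡y-x x y) (∣m⇒∣-m a∣x-y)

gcd-*-invertible : ∀ a k u → a ∣ k * u - 1ℤ → ∀ c → gcd a (k * c) ≡ gcd a c
gcd-*-invertible a k u a∣ku-1 c = gcd-antisym a (k * c) c
  (subst (gcd a (k * c) ∣ᵤ_) (gcd-cong a (u * (k * c)) c a∣ukc-c) (gcd∣gcd[*] a u (k * c)))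
  (gcd∣gcd[*] a k c)
  where
  ukc-c≡[ku-1]c : ∀ k u c → u * (k * c) - c ≡ (k * u - 1ℤ) * c
  ukc-c≡[ku-1]c = solve-∀
  a∣ukc-c : a ∣ u * (k * c) - c
  a∣ukc-c = subst (a ∣_) (sym (ukc-c≡[ku-1]c k u c)) (∣m⇒∣m*n c a∣ku-1)

record AssociatedMod (a b d : ℤ) : Set where
  constructor associated
  field
    k u        : ℤ
    inverse    : a ∣ k * u - 1ℤ
    congruence : a ∣ b - k * d

associatedMod-sym : ∀ {a b d} → AssociatedMod a b d → AssociatedMod a d b
associatedMod-sym {a} {b} {d} (associated k u a∣ku-1 a∣b-kd) =
  associated u k (subst (a ∣_) (uk-1≡ku-1 u k) a∣ku-1) (subst (a ∣_) (sym (d-ub≡ d b k u)) a∣d-ub)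
  where
  a∣d-ub : a ∣ - (u * (b - k * d)) - (k * u - 1ℤ) * d
  a∣d-ub = ∣m∣n⇒∣m-n (∣m⇒∣-m (∣n⇒∣m*n u a∣b-kd)) (∣m⇒∣m*n d a∣ku-1)
  uk-1≡ku-1 : ∀ u k → k * u - 1ℤ ≡ u * k - 1ℤ
  uk-1≡ku-1 = solve-∀
  d-ub≡ : ∀ d b k u → d - u * b ≡ - (u * (b - k * d)) - (k * u - 1ℤ) * d
  d-ub≡ = solve-∀

associatedMod-neg : ∀ {a b d} → AssociatedMod a b d → AssociatedMod a (- b) d
associatedMod-neg {a} {b} {d} (associated k u a∣ku-1 a∣b-kd) =
  associated (- k) (- u) (subst (a ∣_) (sym ([-k][-u]≡ku k u)) a∣ku-1)
    (subst (a ∣_) (sym (-b+kd≡ b k d)) (∣m⇒∣-m a∣b-kd))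
  where
  [-k][-u]≡ku : ∀ k u → - k * - u - 1ℤ ≡ k * u - 1ℤ
  [-k][-u]≡ku = solve-∀
  -b+kd≡ : ∀ b k d → - b - - k * d ≡ - (b - k * d)
  -b+kd≡ = solve-∀

associatedMod-gcd-pos : ∀ a n → a ≢ 0ℤ → AssociatedMod a (+ n) (gcd a (+ n))
associatedMod-gcd-pos a n a≢0 = build (∃-coprime-≡-mod A n (a≢0 ∘ ∣i∣≡0⇒i≡0))
  where
  A = ∣ a ∣
  D = ℕ.gcd A n
  n-[n+t]≡-t : ∀ n t → n - (n + t) ≡ - t
  n-[n+t]≡-t = solve-∀
  build : ∃[ K ] ∃[ m ] Coprime K A × K ℕ.* D ≡ n ℕ.+ m ℕ.* A → AssociatedMod a (+ n) (gcd a (+ n))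
  build (K , m , K⊥A , KD≡n+mA) =
    associated (+ K) u (∣-trans m∣∣m∣ A∣Ku-1) (∣-trans m∣∣m∣ (divides (- + m) n-KD≡-mA))
    where
    u = proj₁ (∃-inverse-mod K⊥A)
    A∣Ku-1 : + A ∣ + K * u - 1ℤ
    A∣Ku-1 = proj₂ (∃-inverse-mod K⊥A)
    n-KD≡-mA : + n - + K * + D ≡ - + m * + A
    n-KD≡-mA = begin
      + n - + K * + D         ≡⟨ cong (_-_ (+ n)) (pos-* K D) ⟨
      + n - + (K ℕ.* D)        ≡⟨ cong (λ t → + n - + t) KD≡n+mA ⟩
      + n - + (n ℕ.+ m ℕ.* A)   ≡⟨ cong (_-_ (+ n)) (pos-+-* n m A) ⟩
      + n - (+ n + + m * + A) ≡⟨ n-[n+t]≡-t (+ n) (+ m * + A) ⟩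
      - (+ m * + A)           ≡⟨ neg-distribˡ-* (+ m) (+ A) ⟩
      - + m * + A             ∎

associatedMod-gcd : ∀ a b → a ≢ 0ℤ → AssociatedMod a b (gcd a b)
associatedMod-gcd a (+ n)    a≢0 = associatedMod-gcd-pos a n a≢0
associatedMod-gcd a -[1+ n ] a≢0 = associatedMod-neg (associatedMod-gcd-pos a (ℕ.suc n) a≢0)

InG-associatedMod : ∀ {a b d x y} → AssociatedMod a b d → InG a d x y → InG a b x y
InG-associatedMod {a} {b} {d} (associated k u a∣ku-1 a∣b-kd) (c , refl , refl) =
  k * c , gcd-*-invertible a k u a∣ku-1 c , (begin
    gcd a (b - k * c)   ≡⟨ gcd-cong a (b - k * c) (k * (d - c)) a∣b-kc-k[d-c] ⟩
    gcd a (k * (d - c)) ≡⟨ gcd-*-invertible a k u a∣ku-1 (d - c) ⟩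
    gcd a (d - c)       ∎)
  where
  [b-kc]-k[d-c]≡b-kd : ∀ b k c d → (b - k * c) - k * (d - c) ≡ b - k * d
  [b-kc]-k[d-c]≡b-kd = solve-∀
  a∣b-kc-k[d-c] : a ∣ (b - k * c) - k * (d - c)
  a∣b-kc-k[d-c] = subst (a ∣_) (sym ([b-kc]-k[d-c]≡b-kd b k c d)) a∣b-kd

proposition4p2 : (a b : ℤ) → a ≢ 0ℤ → b ≢ 0ℤ → (x y : ℤ) → (InG a b x y → InG a (gcd a b) x y) × (InG a (gcd a b) x y → InG a b x y)
proposition4p2 a b a≢0 _ x y = InG-associatedMod (associatedMod-sym b∼d) , InG-associatedMod b∼d
  where
  b∼d : AssociatedMod a b (gcd a b)
  b∼d = associatedMod-gcd a b a≢0
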